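{- Let $\mathsf{XL}\in\{\mathsf{IntQL},\mathsf{IntQCL}\}$. Suppose $\mathcal{R},w\le u,\Gamma\Rightarrow\Delta$ is derivable in $\mathsf{XL}$ and $u$ is reachable from $w$ in $\mathcal{R}$. Then $\mathcal{R},\Gamma\Rightarrow\Delta$ is derivable in $\mathsf{XL}$.
   Context: Language: parameters $\underline{a},\dots$, bound variables $x,\dots$; $\phi::=p(\vec{\underline{a}})\mid\bot\mid\phi\wedge\phi\mid\phi\vee\phi\mid\phi\to\phi\mid\exists x\phi\mid\forall x\phi$. Labelled sequents $\mathcal{R},\Gamma\Rightarrow\Delta$: $\mathcal{R}$ a multiset of relational atoms $w\le u$ (possibly also domain atoms $\underline{a}\in D_w$, unused by the rules), $\Gamma,\Delta$ multisets of labelled formulas. $u$ is reachable from $w$ in $\mathcal{R}$ if $u=w$ or $\mathcal{R}$ contains $w\le v_1,\dots,v_n\le u$; connected: linked by a chain of atoms in either direction. $\underline{a}$ is $S4$-available ($S5$-available) for $w$ if some $v:\psi\in\Gamma\cup\Delta$ contains $\underline{a}$ with $w$ reachable from $v$ ($v,w$ connected). Eigenvariable: not in the conclusion. Rules of $\mathsf{IntXL}$, $\mathsf{X}\in\{\mathsf{Q},\mathsf{QC}\}$: $(id_*)$: $\mathcal{R},\Gamma,w:p(\vec{\underline{a}})\Rightarrow u:p(\vec{\underline{a}}),\Delta$, $u$ reachable from $w$; $(\bot_l)$: $\mathcal{R},\Gamma,w:\bot\Rightarrow\Delta$; $(\wedge_l),(\wedge_r),(\vee_l),(\vee_r)$ standard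 at one label with shared contexts; $(\to_r)$: $\mathcal{R},w\le u,\Gamma,u:\phi\Rightarrow u:\psi,\Delta$ / $\mathcal{R},\Gamma\Rightarrow w:\phi\to\psi,\Delta$, $u$ eigenvariable; $(Pr_\to)$: $\mathcal{R},w:\phi\to\psi,\Gamma\Rightarrow\Delta,u:\phi$ and $\mathcal{R},w:\phi\to\psi,u:\psi,\Gamma\Rightarrow\Delta$ / $\mathcal{R},w:\phi\to\psi,\Gamma\Rightarrow\Delta$, $u$ reachable from $w$; $(\exists_r)$: $\mathcal{R},\Gamma\Rightarrow\Delta,w:\phi(\underline{a}/x),w:\exists x\phi$ / $\mathcal{R},\Gamma\Rightarrow\Delta,w:\exists x\phi$, $\underline{a}$ $S4$- ($\mathsf{Q}$) resp. $S5$-available ($\mathsf{QC}$) for $w$ or eigenvariable; $(\forall_l)$: $\mathcal{R},w:\forall x\phi,v:\phi(\underline{a}/x),\Gamma\Rightarrow\Delta$ / $\mathcal{R},w:\forall x\phi,\Gamma\Rightarrow\Delta$, $\underline{a}$ $S4$- ($\mathsf{Q}$) resp. $S5$-available ($\mathsf{QC}$) for $v$ or eigenvariable, and $v$ reachable from $w$; $(\forall_r)$: $\mathcal{R},w\le u,\Gamma\Rightarrow u:\phi(\underline{a}/x),\Delta$ / $\mathcal{R},\Gamma\Rightarrow w:\forall x\phi,\Delta$, $\underline{a},u$ eigenvariables; $(\exists_l)$: $\mathcal{R},\Gamma,w:\phi(\underline{a}/x)\Rightarrow\Delta$ / $\mathcal{R},\Gamma,w:\exists x\phi\Rightarrow\Delta$,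 $\underline{a}$ eigenvariable. $\mathsf{IntQL}$: $\mathsf{X}=\mathsf{Q}$; $\mathsf{IntQCL}$: $\mathsf{X}=\mathsf{QC}$. -}

module Defs where

open import Data.Nat using (ℕ; _≡ᵇ_)
open import Data.Bool using (if_then_else_)
open import Data.List using (List; []; _∷_; _++_; map)
open import Data.List.Membership.Propositional using (_∈_)
open import Data.List.Relation.Unary.Any using (Any)
open import Data.List.Relation.Binary.Permutation.Propositional using (_↭_)
open import Data.Product using (Σ; _×_; ∃)
open import Data.Sum using (_⊎_)
open import Relation.Nullary using (¬_)
open import Relation.Binary.PropositionalEquality using (_≡_)

Param : Set
Param = ℕ

Var : Set
Var = ℕ

Label : Set
Label = ℕ

data Term : Set where
  par : Param → Term
  var : Var → Term

data Formula : Set where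
  atom : ℕ → List Term → Formula
  ⊥'   : Formula
  _∧'_ : Formula → Formula → Formula
  _∨'_ : Formula → Formula → Formula
  _⇒'_ : Formula → Formula → Formula
  ∃'   : Var → Formula → Formula
  ∀'   : Var → Formula → Formula

substT : Param → Var → Term → Term
substT a x (par b) = par b
substT a x (var y) = if x ≡ᵇ y then par a else var y

subst : Param → Var → Formula → Formula
subst a x (atom p ts) = atom p (map (substT a x) ts)
subst a x ⊥' = ⊥'
subst a x (φ ∧' ψ) = subst a x φ ∧' subst a x ψ
subst a x (φ ∨' ψ) = subst a x φ ∨' subst a x ψ
subst a x (φ ⇒' ψ) = subst a x φ ⇒' subst a x ψ
subst a x (∃' y φ) = if x ≡ᵇ y then ∃' y φ else ∃' y (subst a x φ)
subst a x (∀' y φ) = if x ≡ᵇ y then ∀' y φ else ∀' y (subst a x φ)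

data ParamIn (a : Param) : Formula → Set where
  atom : ∀ {p ts} → par a ∈ ts → ParamIn a (atom p ts)
  ∧ˡ : ∀ {φ ψ} → ParamIn a φ → ParamIn a (φ ∧' ψ)
  ∧ʳ : ∀ {φ ψ} → ParamIn a ψ → ParamIn a (φ ∧' ψ)
  ∨ˡ : ∀ {φ ψ} → ParamIn a φ → ParamIn a (φ ∨' ψ)
  ∨ʳ : ∀ {φ ψ} → ParamIn a ψ → ParamIn a (φ ∨' ψ)
  ⇒ˡ : ∀ {φ ψ} → ParamIn a φ → ParamIn a (φ ⇒' ψ)
  ⇒ʳ : ∀ {φ ψ} → ParamIn a ψ → ParamIn a (φ ⇒' ψ)
  ∃' : ∀ {x φ} → ParamIn a φ → ParamIn a (∃' x φ)
  ∀' : ∀ {x φ} → ParamIn a φ → ParamIn a (∀' x φ)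

data LFormula : Set where
  _∶_ : Label → Formula → LFormula

label : LFormula → Label
label (w ∶ φ) = w

formula : LFormula → Formula
formula (w ∶ φ) = φ

data RAtom : Set where
  _≤ʳ_ : Label → Label → RAtom
  _∈D_ : Param → Label → RAtom

-- multisets are lists taken up to permutation (see the rule `perm` below)
Rel : Set
Rel = List RAtom

Ctx : Set
Ctx = List LFormula

data Reach (R : Rel) : Label → Label → Set where
  here : ∀ {w} → Reach R w w
  step : ∀ {w v u} → (w ≤ʳ v) ∈ R → Reach R v u → Reach R w u

data Conn (R : Rel) : Label → Label → Set where
  here : ∀ {w} → Conn R w w
  fwd  : ∀ {w v u} → (w ≤ʳ v) ∈ R → Conn R v u → Conn R w u
  bwd  : ∀ {w v u} → (v ≤ʳ w) ∈ R → Conn R v u → Conn R w u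

data LabelInAtom (u : Label) : RAtom → Set where
  src : ∀ {v} → LabelInAtom u (u ≤ʳ v)
  tgt : ∀ {v} → LabelInAtom u (v ≤ʳ u)
  D  : ∀ {a} → LabelInAtom u (a ∈D u)

data ParamInAtom (a : Param) : RAtom → Set where
  D : ∀ {w} → ParamInAtom a (a ∈D w)

LabelOcc : Label → Rel → Ctx → Ctx → Set
LabelOcc u R Γ Δ =
  Any (LabelInAtom u) R ⊎ Any (λ A → label A ≡ u) (Γ ++ Δ)

ParamOcc : Param → Rel → Ctx → Ctx → Set
ParamOcc a R Γ Δ =
  Any (ParamInAtom a) R ⊎ Any (λ A → ParamIn a (formula A)) (Γ ++ Δ)

data Logic : Set where
  IntQL IntQCL : Logic

Avail : Logic → Param → Label → Rel → Ctx → Ctx → Set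
Avail IntQL  a w R Γ Δ =
  Σ Label λ v → Σ Formula λ ψ → ((v ∶ ψ) ∈ (Γ ++ Δ)) × ParamIn a ψ × Reach R v w
Avail IntQCL a w R Γ Δ =
  Σ Label λ v → Σ Formula λ ψ → ((v ∶ ψ) ∈ (Γ ++ Δ)) × ParamIn a ψ × Conn R v w

-- side condition of (∃r) and (∀l): available, or an eigenvariable
AvailOrFresh : Logic → Param → Label → Rel → Ctx → Ctx → Set
AvailOrFresh X a w R Γ Δ = Avail X a w R Γ Δ ⊎ ¬ ParamOcc a R Γ Δ

-- Derivability in IntXL of the sequent R, Γ ⇒ Δ.
-- Principal formulas are written at the head of the lists; `perm`
-- makes derivability invariant under permutation, i.e. sequents are
-- multisets.
data Der (X : Logic) : Rel → Ctx → Ctx → Set where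
  perm : ∀ {R R' Γ Γ' Δ Δ'} → R ↭ R' → Γ ↭ Γ' → Δ ↭ Δ' →
         Der X R Γ Δ → Der X R' Γ' Δ'
  id*  : ∀ {R Γ Δ w u p ts} → Reach R w u →
         Der X R ((w ∶ atom p ts) ∷ Γ) ((u ∶ atom p ts) ∷ Δ)
  ⊥ₗ   : ∀ {R Γ Δ w} → Der X R ((w ∶ ⊥') ∷ Γ) Δ
  ∧ₗ   : ∀ {R Γ Δ w φ ψ} →
         Der X R ((w ∶ φ) ∷ (w ∶ ψ) ∷ Γ) Δ →
         Der X R ((w ∶ (φ ∧' ψ)) ∷ Γ) Δ
  ∧ᵣ   : ∀ {R Γ Δ w φ ψ} →
         Der X R Γ ((w ∶ φ) ∷ Δ) → Der X R Γ ((w ∶ ψ) ∷ Δ) →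
         Der X R Γ ((w ∶ (φ ∧' ψ)) ∷ Δ)
  ∨ₗ   : ∀ {R Γ Δ w φ ψ} →
         Der X R ((w ∶ φ) ∷ Γ) Δ → Der X R ((w ∶ ψ) ∷ Γ) Δ →
         Der X R ((w ∶ (φ ∨' ψ)) ∷ Γ) Δ
  ∨ᵣ   : ∀ {R Γ Δ w φ ψ} →
         Der X R Γ ((w ∶ φ) ∷ (w ∶ ψ) ∷ Δ) →
         Der X R Γ ((w ∶ (φ ∨' ψ)) ∷ Δ)
  ⇒ᵣ   : ∀ {R Γ Δ w u φ ψ} →
         ¬ LabelOcc u R Γ ((w ∶ (φ ⇒' ψ)) ∷ Δ) →
         Der X ((w ≤ʳ u) ∷ R) ((u ∶ φ) ∷ Γ) ((u ∶ ψ) ∷ Δ) →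
         Der X R Γ ((w ∶ (φ ⇒' ψ)) ∷ Δ)
  Pr⇒  : ∀ {R Γ Δ w u φ ψ} → Reach R w u →
         Der X R ((w ∶ (φ ⇒' ψ)) ∷ Γ) ((u ∶ φ) ∷ Δ) →
         Der X R ((u ∶ ψ) ∷ (w ∶ (φ ⇒' ψ)) ∷ Γ) Δ →
         Der X R ((w ∶ (φ ⇒' ψ)) ∷ Γ) Δ
  ∃ᵣ   : ∀ {R Γ Δ w x φ a} →
         AvailOrFresh X a w R Γ ((w ∶ ∃' x φ) ∷ Δ) →
         Der X R Γ ((w ∶ subst a x φ) ∷ (w ∶ ∃' x φ) ∷ Δ) →
         Der X R Γ ((w ∶ ∃' x φ) ∷ Δ)
  ∀ₗ   : ∀ {R Γ Δ w v x φ a} → Reach R w v →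
         AvailOrFresh X a v R ((w ∶ ∀' x φ) ∷ Γ) Δ →
         Der X R ((v ∶ subst a x φ) ∷ (w ∶ ∀' x φ) ∷ Γ) Δ →
         Der X R ((w ∶ ∀' x φ) ∷ Γ) Δ
  ∀ᵣ   : ∀ {R Γ Δ w u x φ a} →
         ¬ LabelOcc u R Γ ((w ∶ ∀' x φ) ∷ Δ) →
         ¬ ParamOcc a R Γ ((w ∶ ∀' x φ) ∷ Δ) →
         Der X ((w ≤ʳ u) ∷ R) Γ ((u ∶ subst a x φ) ∷ Δ) →
         Der X R Γ ((w ∶ ∀' x φ) ∷ Δ)
  ∃ₗ   : ∀ {R Γ Δ w x φ a} →
         ¬ ParamOcc a R ((w ∶ ∃' x φ) ∷ Γ) Δ →
         Der X R ((w ∶ subst a x φ) ∷ Γ) Δ →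
         Der X R ((w ∶ ∃' x φ) ∷ Γ) Δ

{-# OPTIONS --safe #-}
module Submission where

-- Adding an atom w ≤ u with u already reachable from w leaves reachability
-- and connectedness unchanged, and it can only add occurrences of labels and
-- parameters; so every side condition of a rule instance in R, w ≤ u, … stays
-- true in R, … and the derivation can be replayed atom-free. The induction has
-- to be over arbitrary extensions of R by redundant atoms, since (⇒ᵣ) and (∀ᵣ)
-- extend the relational part of the premise.

open import Defs
open import Data.List using (_∷_)
open import Data.List.Membership.Propositional using (_∈_)
open import Data.List.Relation.Unary.Any using (Any; here; there)
open import Data.List.Relation.Binary.Permutation.Propositional using (_↭_; ↭-refl; ↭-sym)
open import Data.List.Relation.Binary.Subset.Propositional using (_⊆_)
open import Data.List.Relation.Binary.Subset.Propositional.Properties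
  using (Any-resp-⊆; ⊆-reflexive-↭; xs⊆x∷xs; ∷⁺ʳ)
open import Data.Product using (_,_)
open import Data.Sum using (_⊎_)
import Data.Sum as Sum
open import Function using (_∘_)
open import Relation.Binary.PropositionalEquality using (refl)
open import Relation.Nullary using (¬_)

Reach-trans : ∀ {R v w u} → Reach R v w → Reach R w u → Reach R v u
Reach-trans here        q = q
Reach-trans (step v≤ p) q = step v≤ (Reach-trans p q)

Reach-mono : ∀ {R R′ v w} → R ⊆ R′ → Reach R v w → Reach R′ v w
Reach-mono R⊆R′ here        = here
Reach-mono R⊆R′ (step v≤ p) = step (R⊆R′ v≤) (Reach-mono R⊆R′ p)

Conn-trans : ∀ {R v w u} → Conn R v w → Conn R w u → Conn R v u
Conn-trans here      q = q
Conn-trans (fwd e p) q = fwd e (Conn-trans p q)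
Conn-trans (bwd e p) q = bwd e (Conn-trans p q)

Conn-sym : ∀ {R v w} → Conn R v w → Conn R w v
Conn-sym here      = here
Conn-sym (fwd e p) = Conn-trans (Conn-sym p) (bwd e here)
Conn-sym (bwd e p) = Conn-trans (Conn-sym p) (fwd e here)

Reach⇒Conn : ∀ {R v w} → Reach R v w → Conn R v w
Reach⇒Conn here        = here
Reach⇒Conn (step v≤ p) = fwd v≤ (Reach⇒Conn p)

record RedundantExt (R R⁺ : Rel) : Set where
  field
    ⊆-ext          : R ⊆ R⁺
    edge-reachable : ∀ {v w} → (v ≤ʳ w) ∈ R⁺ → Reach R v w

open RedundantExt

module _ {R R⁺ : Rel} (ext : RedundantExt R R⁺) where

  Reach-resp-ext : ∀ {v w} → Reach R⁺ v w → Reach R v w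
  Reach-resp-ext here        = here
  Reach-resp-ext (step v≤ p) = Reach-trans (edge-reachable ext v≤) (Reach-resp-ext p)

  Conn-resp-ext : ∀ {v w} → Conn R⁺ v w → Conn R v w
  Conn-resp-ext here      = here
  Conn-resp-ext (fwd e p) = Conn-trans (Reach⇒Conn (edge-reachable ext e)) (Conn-resp-ext p)
  Conn-resp-ext (bwd e p) =
    Conn-trans (Conn-sym (Reach⇒Conn (edge-reachable ext e))) (Conn-resp-ext p)

  -- Covers both ¬ LabelOcc and ¬ ParamOcc, which unfold to this shape.
  fresh-resp-ext : ∀ {P : RAtom → Set} {B : Set} → ¬ (Any P R⁺ ⊎ B) → ¬ (Any P R ⊎ B)
  fresh-resp-ext fresh = fresh ∘ Sum.map₁ (Any-resp-⊆ (⊆-ext ext))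

  Avail-resp-ext : ∀ X {a w} Γ Δ → Avail X a w R⁺ Γ Δ → Avail X a w R Γ Δ
  Avail-resp-ext IntQL  Γ Δ (v , ψ , v∶ψ , a∈ψ , r) = v , ψ , v∶ψ , a∈ψ , Reach-resp-ext r
  Avail-resp-ext IntQCL Γ Δ (v , ψ , v∶ψ , a∈ψ , c) = v , ψ , v∶ψ , a∈ψ , Conn-resp-ext c

  AvailOrFresh-resp-ext : ∀ {X a w} Γ Δ →
    AvailOrFresh X a w R⁺ Γ Δ → AvailOrFresh X a w R Γ Δ
  AvailOrFresh-resp-ext {X} Γ Δ = Sum.map (Avail-resp-ext X Γ Δ) fresh-resp-ext

RedundantExt-∷ : ∀ {R R⁺} x → RedundantExt R R⁺ → RedundantExt (x ∷ R) (x ∷ R⁺)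
RedundantExt-∷ x ext = record
  { ⊆-ext          = ∷⁺ʳ x (⊆-ext ext)
  ; edge-reachable = λ where
      (here refl) → step (here refl) here
      (there e)   → Reach-mono (xs⊆x∷xs _ x) (edge-reachable ext e)
  }

RedundantExt-resp-↭ : ∀ {R R⁺ R⁺′} → R⁺ ↭ R⁺′ → RedundantExt R R⁺′ → RedundantExt R R⁺
RedundantExt-resp-↭ p ext = record
  { ⊆-ext          = ⊆-reflexive-↭ (↭-sym p) ∘ ⊆-ext ext
  ; edge-reachable = edge-reachable ext ∘ ⊆-reflexive-↭ p
  }

reachable-edge-redundant : ∀ {R w u} → Reach R w u → RedundantExt R ((w ≤ʳ u) ∷ R)
reachable-edge-redundant r = record
  { ⊆-ext          = there
  ; edge-reachable = λ where
      (here refl) → r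
      (there e)   → step e here
  }

Der-resp-ext : ∀ {X R R⁺ Γ Δ} → RedundantExt R R⁺ → Der X R⁺ Γ Δ → Der X R Γ Δ
Der-resp-ext ext (perm p q s d) = perm ↭-refl q s (Der-resp-ext (RedundantExt-resp-↭ p ext) d)
Der-resp-ext ext (id* r)        = id* (Reach-resp-ext ext r)
Der-resp-ext ext ⊥ₗ             = ⊥ₗ
Der-resp-ext ext (∧ₗ d)         = ∧ₗ (Der-resp-ext ext d)
Der-resp-ext ext (∧ᵣ d e)       = ∧ᵣ (Der-resp-ext ext d) (Der-resp-ext ext e)
Der-resp-ext ext (∨ₗ d e)       = ∨ₗ (Der-resp-ext ext d) (Der-resp-ext ext e)
Der-resp-ext ext (∨ᵣ d)         = ∨ᵣ (Der-resp-ext ext d)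
Der-resp-ext ext (⇒ᵣ fresh d)   =
  ⇒ᵣ (fresh-resp-ext ext fresh) (Der-resp-ext (RedundantExt-∷ _ ext) d)
Der-resp-ext ext (Pr⇒ r d e)    = Pr⇒ (Reach-resp-ext ext r) (Der-resp-ext ext d) (Der-resp-ext ext e)
Der-resp-ext ext (∃ᵣ {Γ = Γ} {Δ} {w} {x} {φ} side d) =
  ∃ᵣ (AvailOrFresh-resp-ext ext Γ ((w ∶ ∃' x φ) ∷ Δ) side) (Der-resp-ext ext d)
Der-resp-ext ext (∀ₗ {Γ = Γ} {Δ} {w} {x = x} {φ} r side d) =
  ∀ₗ (Reach-resp-ext ext r) (AvailOrFresh-resp-ext ext ((w ∶ ∀' x φ) ∷ Γ) Δ side)
     (Der-resp-ext ext d)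
Der-resp-ext ext (∀ᵣ freshᵤ freshₐ d) =
  ∀ᵣ (fresh-resp-ext ext freshᵤ) (fresh-resp-ext ext freshₐ)
     (Der-resp-ext (RedundantExt-∷ _ ext) d)
Der-resp-ext ext (∃ₗ fresh d)   = ∃ₗ (fresh-resp-ext ext fresh) (Der-resp-ext ext d)

mainTheorem10 : (X : Logic) (R : Rel) (Γ Δ : Ctx) (w u : Label) →
    Der X ((w ≤ʳ u) ∷ R) Γ Δ → Reach R w u → Der X R Γ Δ
mainTheorem10 X R Γ Δ w u d r = Der-resp-ext (reachable-edge-redundant r) d
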